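{- Let $\mathcal D$ be a finite non-empty set. For every relational formula $\varphi$ with free variables among $x_1,\dots,x_p,Y_1,\dots,Y_q$, $$X_1(x_1),\dots,X_p(x_p),\ \mathrm{Sing}(X_1),\dots,\mathrm{Sing}(X_p)\ \vdash_{\mathrm{MSO}_{\mathcal D}}\ \varphi\leftrightarrow\varphi^{IF}.$$
   Context: $\mathrm{MSO}_{\mathcal D}$: two-sorted classical theory with Individual variables $x,y,z$, Individual terms $t::=x\mid\mathsf{Root}\mid\mathsf S_d(t)$ ($d\in\mathcal D$), monadic Predicate variables $X,Y$, formulas $X(t)\mid t\doteq u\mid t<u\mid\varphi\lor\psi\mid\neg\varphi\mid\exists x\varphi\mid\exists X\varphi$. Provability: classical natural deduction for two-sorted first-order logic, with axioms: equality ($\forall x\,x\doteq x$, Leibniz scheme); tree axioms $\neg\exists x\bigvee_{d\ne d'}\mathsf S_d(x)\doteq\mathsf S_{d'}(x)$, injectivity of each $\mathsf S_d$, $\neg\exists x\,x<x$, transitivity of $<$, $\forall x\,\mathsf{Root}\le x$, $\forall x\forall y\bigwedge_d(x<\mathsf S_d(y)\leftrightarrow x\le y)$ ($t\le u:=t<u\lor t\doteq u$); comprehension $\exists X\forall y(X(y)\leftrightarrow\varphi)$ ($X$ not free in $\varphi$); induction $\forall X(X(\mathsf{Root})\to\bigwedge_d\forall y(X(y)\to X(\mathsf S_d(y)))\to\forall yX(y))$. $\mathrm{FSucc}_d(x,y):=(\mathsf S_d(x)\doteq y)$. Relational formulas are built from atoms $X(y)$ ($y$ a variable) and $\mathrm{FSucc}_d(x,y)$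 by $\neg$, $\lor$, $\exists x$, $\exists X$. Defined MSO formulas: $X\subseteq Y:=\forall x(X(x)\to Y(x))$; $\mathrm{FSucc}_d(X,Y):=\exists x\exists y(X(x)\land Y(y)\land\mathrm{FSucc}_d(x,y))$; $X\doteq\emptyset:=\forall Y(X\subseteq Y)$; $\mathrm{Sing}(X):=\neg(X\doteq\emptyset)\land\forall Y(Y\subseteq X\to(Y\doteq\emptyset\lor X\subseteq Y))$. For a relational formula $\varphi$ with free variables among $x_1,\dots,x_p,Y_1,\dots,Y_q$, $\varphi^{IF}$ (free variables among $X_1,\dots,X_p,Y_1,\dots,Y_q$) is defined by: $(Y_j(x_i))^{IF}=X_i\subseteq Y_j$; $(\mathrm{FSucc}_d(x_i,x_j))^{IF}=\mathrm{FSucc}_d(X_i,X_j)$; commutes with $\neg$, $\lor$; $(\exists Y_{q+1}\varphi)^{IF}=\exists Y_{q+1}\varphi^{IF}$; $(\exists x_{p+1}\varphi)^{IF}=\exists X_{p+1}(\mathrm{Sing}(X_{p+1})\land\varphi^{IF})$. -}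

module Defs where

open import Data.Nat using (ℕ; zero; suc; _+_)
open import Data.Fin using (Fin; zero; suc; punchIn; _↑ˡ_; _↑ʳ_)
open import Data.List using (List; []; _∷_; map; _++_; allFin)
open import Data.List.Membership.Propositional using (_∈_)

-- MSO_D with D = Fin (suc k)  (an arbitrary finite non-empty set, up to
-- bijection).  Index `zero` = most recently bound.

Dir : ℕ → Set
Dir k = Fin (suc k)

data Term (k n : ℕ) : Set where
  var  : Fin n → Term k n
  Root : Term k n
  S    : Dir k → Term k n → Term k n

infix  7 _≐_ _≺_
infixr 6 _∨ᶠ_

data Formula (k n m : ℕ) : Set where
  P    : Fin m → Term k n → Formula k n m
  _≐_  : Term k n → Term k n → Formula k n m
  _≺_  : Term k n → Term k n → Formula k n m
  _∨ᶠ_ : Formula k n m → Formula k n m → Formula k n m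
  ¬ᶠ_  : Formula k n m → Formula k n m
  ∃ᵢ   : Formula k (suc n) m → Formula k n m
  ∃ₚ   : Formula k n (suc m) → Formula k n m

ext : ∀ {a b} → (Fin a → Fin b) → Fin (suc a) → Fin (suc b)
ext ρ zero    = zero
ext ρ (suc i) = suc (ρ i)

renT : ∀ {k n n'} → (Fin n → Fin n') → Term k n → Term k n'
renT ρ (var i) = var (ρ i)
renT ρ Root    = Root
renT ρ (S d t) = S d (renT ρ t)

substT : ∀ {k n n'} → (Fin n → Term k n') → Term k n → Term k n'
substT σ (var i) = σ i
substT σ Root    = Root
substT σ (S d t) = S d (substT σ t)

extS : ∀ {k n n'} → (Fin n → Term k n') → Fin (suc n) → Term k (suc n')
extS σ zero    = var zero
extS σ (suc i) = renT suc (σ i)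

substI : ∀ {k n n' m} → (Fin n → Term k n') → Formula k n m → Formula k n' m
substI σ (P X t)  = P X (substT σ t)
substI σ (t ≐ u)  = substT σ t ≐ substT σ u
substI σ (t ≺ u)  = substT σ t ≺ substT σ u
substI σ (φ ∨ᶠ ψ) = substI σ φ ∨ᶠ substI σ ψ
substI σ (¬ᶠ φ)   = ¬ᶠ substI σ φ
substI σ (∃ᵢ φ)   = ∃ᵢ (substI (extS σ) φ)
substI σ (∃ₚ φ)   = ∃ₚ (substI σ φ)

renP : ∀ {k n m m'} → (Fin m → Fin m') → Formula k n m → Formula k n m'
renP ρ (P X t)  = P (ρ X) t
renP ρ (t ≐ u)  = t ≐ u
renP ρ (t ≺ u)  = t ≺ u
renP ρ (φ ∨ᶠ ψ) = renP ρ φ ∨ᶠ renP ρ ψ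
renP ρ (¬ᶠ φ)   = ¬ᶠ renP ρ φ
renP ρ (∃ᵢ φ)   = ∃ᵢ (renP ρ φ)
renP ρ (∃ₚ φ)   = ∃ₚ (renP (ext ρ) φ)

wkI : ∀ {k n m} → Formula k n m → Formula k (suc n) m
wkI = substI (λ i → var (suc i))

wkP : ∀ {k n m} → Formula k n m → Formula k n (suc m)
wkP = renP suc

_[_]ᵢ : ∀ {k n m} → Formula k (suc n) m → Term k n → Formula k n m
φ [ t ]ᵢ = substI (λ { zero → t ; (suc i) → var i }) φ

_[_]ₚ : ∀ {k n m} → Formula k n (suc m) → Fin m → Formula k n m
φ [ Y ]ₚ = renP (λ { zero → Y ; (suc i) → i }) φ

infixr 5 _∧ᶠ_
infixr 4 _⇒ᶠ_
infix  3 _⇔ᶠ_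

_∧ᶠ_ : ∀ {k n m} → Formula k n m → Formula k n m → Formula k n m
φ ∧ᶠ ψ = ¬ᶠ (¬ᶠ φ ∨ᶠ ¬ᶠ ψ)

_⇒ᶠ_ : ∀ {k n m} → Formula k n m → Formula k n m → Formula k n m
φ ⇒ᶠ ψ = ¬ᶠ φ ∨ᶠ ψ

_⇔ᶠ_ : ∀ {k n m} → Formula k n m → Formula k n m → Formula k n m
φ ⇔ᶠ ψ = (φ ⇒ᶠ ψ) ∧ᶠ (ψ ⇒ᶠ φ)

∀ᵢ : ∀ {k n m} → Formula k (suc n) m → Formula k n m
∀ᵢ φ = ¬ᶠ ∃ᵢ (¬ᶠ φ)

∀ₚ : ∀ {k n m} → Formula k n (suc m) → Formula k n m
∀ₚ φ = ¬ᶠ ∃ₚ (¬ᶠ φ)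

_≼_ : ∀ {k n m} → Term k n → Term k n → Formula k n m
t ≼ u = t ≺ u ∨ᶠ t ≐ u

⊥ᶠ : ∀ {k n m} → Formula k n m
⊥ᶠ = ¬ᶠ (Root ≐ Root)

⊤ᶠ : ∀ {k n m} → Formula k n m
⊤ᶠ = Root ≐ Root

⋁ : ∀ {k n m} (j : ℕ) → (Fin j → Formula k n m) → Formula k n m
⋁ zero    f = ⊥ᶠ
⋁ (suc j) f = f zero ∨ᶠ ⋁ j (λ i → f (suc i))

⋀ : ∀ {k n m} (j : ℕ) → (Fin j → Formula k n m) → Formula k n m
⋀ zero    f = ⊤ᶠ
⋀ (suc j) f = f zero ∧ᶠ ⋀ j (λ i → f (suc i))

v0 v1 v2 : ∀ {k n} → Term k (suc (suc (suc n)))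
v0 = var zero
v1 = var (suc zero)
v2 = var (suc (suc zero))

x0 : ∀ {k n} → Term k (suc n)
x0 = var zero

data Axiom {k n m : ℕ} : Formula k n m → Set where
  eq-refl : Axiom (∀ᵢ (x0 ≐ x0))
  leibniz : (φ : Formula k (suc n) m) →
    Axiom (∀ᵢ (∀ᵢ (var (suc zero) ≐ var zero ⇒ᶠ
       substI (λ { zero → var (suc zero) ; (suc i) → var (suc (suc i)) }) φ ⇒ᶠ
       substI (λ { zero → var zero ; (suc i) → var (suc (suc i)) }) φ)))
  -- ¬∃x ⋁_{d ≠ d'} S_d(x) ≐ S_d'(x)   (d' = punchIn d e ranges over d' ≠ d)
  succ-distinct : Axiom (¬ᶠ ∃ᵢ (⋁ (suc k) (λ d → ⋁ k (λ e → S d x0 ≐ S (punchIn d e) x0))))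
  succ-inj : (d : Dir k) →
    Axiom (∀ᵢ (∀ᵢ (S d (var (suc zero)) ≐ S d (var zero) ⇒ᶠ var (suc zero) ≐ var zero)))
  lt-irrefl : Axiom (¬ᶠ ∃ᵢ (x0 ≺ x0))
  lt-trans : Axiom (∀ᵢ (∀ᵢ (∀ᵢ (v2 ≺ v1 ⇒ᶠ v1 ≺ v0 ⇒ᶠ v2 ≺ v0))))
  root-min : Axiom (∀ᵢ (Root ≼ x0))
  lt-succ : Axiom (∀ᵢ (∀ᵢ (⋀ (suc k) (λ d →
              (var (suc zero) ≺ S d (var zero)) ⇔ᶠ (var (suc zero) ≼ var zero)))))
  -- comprehension ∃X ∀y (X(y) ↔ φ), X not free in φ
  comprehension : (φ : Formula k (suc n) m) →
    Axiom (∃ₚ (∀ᵢ (P zero x0 ⇔ᶠ wkP φ)))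
  induction : Axiom (∀ₚ (P zero Root ⇒ᶠ
                 ⋀ (suc k) (λ d → ∀ᵢ (P zero x0 ⇒ᶠ P zero (S d x0))) ⇒ᶠ
                 ∀ᵢ (P zero x0)))

infix 2 _⊢_

data _⊢_ {k n m : ℕ} : List (Formula k n m) → Formula k n m → Set where
  hyp   : ∀ {Γ φ} → φ ∈ Γ → Γ ⊢ φ
  axiom : ∀ {Γ φ} → Axiom φ → Γ ⊢ φ
  ∨I₁   : ∀ {Γ φ ψ} → Γ ⊢ φ → Γ ⊢ φ ∨ᶠ ψ
  ∨I₂   : ∀ {Γ φ ψ} → Γ ⊢ ψ → Γ ⊢ φ ∨ᶠ ψ
  ∨E    : ∀ {Γ φ ψ χ} → Γ ⊢ φ ∨ᶠ ψ → φ ∷ Γ ⊢ χ → ψ ∷ Γ ⊢ χ → Γ ⊢ χ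
  ¬I    : ∀ {Γ φ ψ} → φ ∷ Γ ⊢ ψ → φ ∷ Γ ⊢ ¬ᶠ ψ → Γ ⊢ ¬ᶠ φ
  ¬E    : ∀ {Γ φ ψ} → Γ ⊢ φ → Γ ⊢ ¬ᶠ φ → Γ ⊢ ψ
  ¬¬E   : ∀ {Γ φ} → Γ ⊢ ¬ᶠ ¬ᶠ φ → Γ ⊢ φ
  ∃ᵢI   : ∀ {Γ φ} (t : Term k n) → Γ ⊢ φ [ t ]ᵢ → Γ ⊢ ∃ᵢ φ
  ∃ᵢE   : ∀ {Γ φ ψ} → Γ ⊢ ∃ᵢ φ → φ ∷ map wkI Γ ⊢ wkI ψ → Γ ⊢ ψ
  ∃ₚI   : ∀ {Γ φ} (Y : Fin m) → Γ ⊢ φ [ Y ]ₚ → Γ ⊢ ∃ₚ φ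
  ∃ₚE   : ∀ {Γ φ ψ} → Γ ⊢ ∃ₚ φ → φ ∷ map wkP Γ ⊢ wkP ψ → Γ ⊢ ψ

data RForm (k p q : ℕ) : Set where
  mem   : Fin q → Fin p → RForm k p q
  fsucc : Dir k → Fin p → Fin p → RForm k p q
  _∨ʳ_  : RForm k p q → RForm k p q → RForm k p q
  ¬ʳ_   : RForm k p q → RForm k p q
  ∃ʳᵢ   : RForm k (suc p) q → RForm k p q
  ∃ʳₚ   : RForm k p (suc q) → RForm k p q

emb : ∀ {k p q} → RForm k p q → Formula k p q
emb (mem j i)     = P j (var i)
emb (fsucc d i j) = S d (var i) ≐ var j
emb (φ ∨ʳ ψ)      = emb φ ∨ᶠ emb ψ
emb (¬ʳ φ)        = ¬ᶠ emb φ
emb (∃ʳᵢ φ)       = ∃ᵢ (emb φ)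
emb (∃ʳₚ φ)       = ∃ₚ (emb φ)

_⊆ᶠ_ : ∀ {k n m} → Fin m → Fin m → Formula k n m
X ⊆ᶠ Y = ∀ᵢ (P X x0 ⇒ᶠ P Y x0)

FSuccP : ∀ {k n m} → Dir k → Fin m → Fin m → Formula k n m
FSuccP d X Y = ∃ᵢ (∃ᵢ (P X (var (suc zero)) ∧ᶠ P Y (var zero) ∧ᶠ
                       S d (var (suc zero)) ≐ var zero))

Empty : ∀ {k n m} → Fin m → Formula k n m
Empty X = ∀ₚ (suc X ⊆ᶠ zero)

Sing : ∀ {k n m} → Fin m → Formula k n m
Sing X = ¬ᶠ Empty X ∧ᶠ ∀ₚ ((zero ⊆ᶠ suc X) ⇒ᶠ (Empty zero ∨ᶠ (suc X ⊆ᶠ zero)))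

-- the IF translation, relative to an assignment ρ of a predicate variable
-- X_i to each individual variable x_i and σ of Y_j's position
IFᵍ : ∀ {k n p q m} → RForm k p q → (Fin p → Fin m) → (Fin q → Fin m) → Formula k n m
IFᵍ (mem j i)     ρ σ = ρ i ⊆ᶠ σ j
IFᵍ (fsucc d i j) ρ σ = FSuccP d (ρ i) (ρ j)
IFᵍ (φ ∨ʳ ψ)      ρ σ = IFᵍ φ ρ σ ∨ᶠ IFᵍ ψ ρ σ
IFᵍ (¬ʳ φ)        ρ σ = ¬ᶠ IFᵍ φ ρ σ
IFᵍ (∃ʳᵢ φ)       ρ σ = ∃ₚ (Sing zero ∧ᶠ IFᵍ φ (ext ρ) (λ j → suc (σ j)))
IFᵍ (∃ʳₚ φ)       ρ σ = ∃ₚ (IFᵍ φ (λ i → suc (ρ i)) (ext σ))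

Xv : ∀ {p} q → Fin p → Fin (p + q)
Xv q i = i ↑ˡ q

Yv : ∀ p {q} → Fin q → Fin (p + q)
Yv p j = p ↑ʳ j

-- φ^IF, free variables among X_1..X_p, Y_1..Y_q (no free individual vars;
-- stated in any individual context n)
IF : ∀ {k n p q} → RForm k p q → Formula k n (p + q)
IF {p = p} {q = q} φ = IFᵍ φ (Xv q) (Yv p)

embXY : ∀ {k p q} → RForm k p q → Formula k p (p + q)
embXY {p = p} φ = renP (Yv p) (emb φ)

Hyps : ∀ k p q → List (Formula k p (p + q))
Hyps k p q = map (λ i → P (Xv q i) (var i)) (allFin p) ++ map (λ i → Sing (Xv q i)) (allFin p)

{-# OPTIONS --safe #-}
-- Generalise to a context that pins every individual variable x to a predicate
-- variable X, i.e. contains X(x) and Sing(X), and prove φ ↔ φ^IF by induction on φ.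
-- Atoms: X has x as its only element, so Y(x) ↔ X ⊆ Y and S_d(x) ≐ y ↔ FSucc_d(X, Y).
-- ∃x: a witness x yields the singleton {x} by comprehension, which pins x;
-- conversely a singleton Z has an element, which it pins.
module Submission where

open import Defs
open import Data.Nat using (ℕ; zero; suc)
open import Data.Fin using (Fin; zero; suc)
open import Data.List using (List; _∷_; map)
open import Data.List.Membership.Propositional using (_∈_)
open import Data.List.Membership.Propositional.Properties using (∈-map⁺; ∈-++⁺ˡ; ∈-++⁺ʳ; ∈-allFin)
open import Data.List.Relation.Binary.Subset.Propositional using (_⊆_)
open import Data.List.Relation.Binary.Subset.Propositional.Properties using (map⁺; ∷⁺ʳ)
open import Data.List.Relation.Unary.Any using (here; there)
open import Data.Product using (_×_; _,_)
open import Function using (id; _∘_)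
open import Relation.Binary.PropositionalEquality using (_≡_; refl; sym; cong; cong₂)

private variable
  k n n' m m' p q : ℕ
  Γ Δ : List (Formula k n m)
  φ ψ χ : Formula k n m

weaken : Γ ⊆ Δ → Γ ⊢ φ → Δ ⊢ φ
weaken s (hyp x)    = hyp (s x)
weaken s (axiom a)  = axiom a
weaken s (∨I₁ h)    = ∨I₁ (weaken s h)
weaken s (∨I₂ h)    = ∨I₂ (weaken s h)
weaken s (∨E h a b) = ∨E (weaken s h) (weaken (∷⁺ʳ _ s) a) (weaken (∷⁺ʳ _ s) b)
weaken s (¬I a b)   = ¬I (weaken (∷⁺ʳ _ s) a) (weaken (∷⁺ʳ _ s) b)
weaken s (¬E a b)   = ¬E (weaken s a) (weaken s b)
weaken s (¬¬E h)    = ¬¬E (weaken s h)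
weaken s (∃ᵢI t h)  = ∃ᵢI t (weaken s h)
weaken s (∃ᵢE h b)  = ∃ᵢE (weaken s h) (weaken (∷⁺ʳ _ (map⁺ wkI s)) b)
weaken s (∃ₚI Y h)  = ∃ₚI Y (weaken s h)
weaken s (∃ₚE h b)  = ∃ₚE (weaken s h) (weaken (∷⁺ʳ _ (map⁺ wkP s)) b)

weaken₁ : Γ ⊢ φ → ψ ∷ Γ ⊢ φ
weaken₁ = weaken there

weaken₂ : Γ ⊢ φ → ψ ∷ χ ∷ Γ ⊢ φ
weaken₂ = weaken (there ∘ there)

hyp₀ : φ ∷ Γ ⊢ φ
hyp₀ = hyp (here refl)

hyp₁ : ψ ∷ φ ∷ Γ ⊢ φ
hyp₁ = hyp (there (here refl))

hyp₂ : ψ ∷ χ ∷ φ ∷ Γ ⊢ φ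
hyp₂ = hyp (there (there (here refl)))

cast : φ ≡ ψ → Γ ⊢ φ → Γ ⊢ ψ
cast refl h = h

cut : Γ ⊢ φ → φ ∷ Γ ⊢ ψ → Γ ⊢ ψ
cut a b = ∨E (∨I₁ a) b b

∀ᵢE : (t : Term k n) → Γ ⊢ ∀ᵢ φ → Γ ⊢ φ [ t ]ᵢ
∀ᵢE t h = ¬¬E (¬I (∃ᵢI t hyp₀) (weaken₁ h))

∀ₚE : (Y : Fin m) → Γ ⊢ ∀ₚ φ → Γ ⊢ φ [ Y ]ₚ
∀ₚE Y h = ¬¬E (¬I (∃ₚI Y hyp₀) (weaken₁ h))

≐-refl : (t : Term k n) → Γ ⊢ t ≐ t
≐-refl t = ∀ᵢE t (axiom eq-refl)

¬I⊥ : φ ∷ Γ ⊢ ⊥ᶠ → Γ ⊢ ¬ᶠ φ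
¬I⊥ = ¬I (≐-refl Root)

by-contradiction : ¬ᶠ φ ∷ Γ ⊢ ⊥ᶠ → Γ ⊢ φ
by-contradiction = ¬¬E ∘ ¬I⊥

excluded-middle : Γ ⊢ φ ∨ᶠ ¬ᶠ φ
excluded-middle = by-contradiction (¬E (∨I₂ (¬I⊥ (¬E (∨I₁ hyp₀) hyp₁))) hyp₀)

∧I : Γ ⊢ φ → Γ ⊢ ψ → Γ ⊢ φ ∧ᶠ ψ
∧I a b = ¬I⊥ (∨E hyp₀ (¬E (weaken₂ a) hyp₀) (¬E (weaken₂ b) hyp₀))

∧E₁ : Γ ⊢ φ ∧ᶠ ψ → Γ ⊢ φ
∧E₁ h = by-contradiction (¬E (∨I₁ hyp₀) (weaken₁ h))

∧E₂ : Γ ⊢ φ ∧ᶠ ψ → Γ ⊢ ψ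
∧E₂ h = by-contradiction (¬E (∨I₂ hyp₀) (weaken₁ h))

⇒I : φ ∷ Γ ⊢ ψ → Γ ⊢ φ ⇒ᶠ ψ
⇒I b = ∨E excluded-middle (∨I₂ b) (∨I₁ hyp₀)

⇒E : Γ ⊢ φ ⇒ᶠ ψ → Γ ⊢ φ → Γ ⊢ ψ
⇒E h a = ∨E h (¬E (weaken₁ a) hyp₀) hyp₀

⇔I : φ ∷ Γ ⊢ ψ → ψ ∷ Γ ⊢ φ → Γ ⊢ φ ⇔ᶠ ψ
⇔I a b = ∧I (⇒I a) (⇒I b)

⇔E₁ : Γ ⊢ φ ⇔ᶠ ψ → Γ ⊢ φ → Γ ⊢ ψ
⇔E₁ = ⇒E ∘ ∧E₁

⇔E₂ : Γ ⊢ φ ⇔ᶠ ψ → Γ ⊢ ψ → Γ ⊢ φ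
⇔E₂ = ⇒E ∘ ∧E₂

∀ᵢI : map wkI Γ ⊢ φ → Γ ⊢ ∀ᵢ φ
∀ᵢI b = ¬I⊥ (∃ᵢE hyp₀ (¬E (weaken₂ b) hyp₀))

∀ₚI : map wkP Γ ⊢ φ → Γ ⊢ ∀ₚ φ
∀ₚI b = ¬I⊥ (∃ₚE hyp₀ (¬E (weaken₂ b) hyp₀))

≐-subst-P : ∀ {a b X} → Γ ⊢ var a ≐ var b → Γ ⊢ P X (var a) → Γ ⊢ P X (var b)
≐-subst-P {a = a} {b} {X} e = ⇒E (⇒E (∀ᵢE (var b) (∀ᵢE (var a) (axiom (leibniz (P X x0))))) e)

≐-sym : ∀ {a b} → Γ ⊢ var a ≐ var b → Γ ⊢ var b ≐ var a
≐-sym {a = a} {b} e =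
  ⇒E (⇒E (∀ᵢE (var b) (∀ᵢE (var a) (axiom (leibniz (x0 ≐ var (suc a)))))) e) (≐-refl (var a))

≐-subst-S-arg : ∀ {a b c d} → Γ ⊢ var a ≐ var b → Γ ⊢ S d (var a) ≐ var c → Γ ⊢ S d (var b) ≐ var c
≐-subst-S-arg {a = a} {b} {c} {d} e =
  ⇒E (⇒E (∀ᵢE (var b) (∀ᵢE (var a) (axiom (leibniz (S d x0 ≐ var (suc c)))))) e)

≐-subst-S-val : ∀ {a b c d} → Γ ⊢ var a ≐ var b → Γ ⊢ S d (var c) ≐ var a → Γ ⊢ S d (var c) ≐ var b
≐-subst-S-val {a = a} {b} {c} {d} e =
  ⇒E (⇒E (∀ᵢE (var b) (∀ᵢE (var a) (axiom (leibniz (S d (var (suc c)) ≐ x0))))) e)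

member⇒nonEmpty : ∀ {X a} → Γ ⊢ P X (var a) → Γ ⊢ ¬ᶠ Empty X
member⇒nonEmpty {a = a} h = cut h (¬I⊥ (∃ₚE (axiom (comprehension ⊥ᶠ))
  (⇔E₁ (∀ᵢE (var a) hyp₀) (⇒E (∀ᵢE (var a) (∀ₚE zero hyp₁)) hyp₂))))

noMember⇒Empty : ∀ {X} → Γ ⊢ ¬ᶠ ∃ᵢ (P X x0) → Γ ⊢ Empty X
noMember⇒Empty h = cut h (∀ₚI (∀ᵢI (⇒I (¬E (∃ᵢI (var zero) hyp₀) hyp₁))))

nonEmpty⇒member : ∀ {X} → Γ ⊢ ¬ᶠ Empty X → Γ ⊢ ∃ᵢ (P X x0)
nonEmpty⇒member h = by-contradiction (¬E (noMember⇒Empty hyp₀) (weaken₁ h))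

-- Minimality of a singleton X, applied to its subset {a}, forces X ⊆ {a}.
Sing-unique : ∀ {X a b} → Γ ⊢ Sing X → Γ ⊢ P X (var a) → Γ ⊢ P X (var b) → Γ ⊢ var b ≐ var a
Sing-unique {Γ = Γ} {X = X} {a} {b} s ha hb = cut s (cut (weaken₁ ha) (cut (weaken₂ hb)
  (∃ₚE (axiom (comprehension (x0 ≐ var (suc a))))
    (∨E (⇒E (∀ₚE zero (∧E₂ (hyp (there (there (there (here refl))))))) Z⊆X)
      (¬E hyp₀ (weaken₁ (member⇒nonEmpty a∈Z)))
      (⇔E₁ (∀ᵢE (var b) hyp₁) (⇒E (∀ᵢE (var b) hyp₀) hyp₂))))))
  where
  ΓZ : List (Formula _ _ (suc _))
  ΓZ = ∀ᵢ (P zero x0 ⇔ᶠ x0 ≐ var (suc a)) ∷ map wkP (P X (var b) ∷ P X (var a) ∷ Sing X ∷ Γ)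
  a∈Z : ΓZ ⊢ P zero (var a)
  a∈Z = ⇔E₂ (∀ᵢE (var a) hyp₀) (≐-refl (var a))
  Z⊆X : ΓZ ⊢ zero ⊆ᶠ suc X
  Z⊆X = ∀ᵢI (⇒I (≐-subst-P (≐-sym (⇔E₁ (∀ᵢE (var zero) hyp₁) hyp₀))
                           (hyp (there (there (there (here refl)))))))

-- A nonempty subset W of {j} contains j, hence all of {j}.
singleton-Sing : ∀ {Z j} → ∀ᵢ (P Z x0 ⇔ᶠ x0 ≐ var (suc j)) ∈ Γ → Γ ⊢ Sing Z
singleton-Sing {Γ = Γ} {Z} {j} Z-def = ∧I (member⇒nonEmpty (⇔E₂ (∀ᵢE (var j) (hyp Z-def)) (≐-refl (var j))))
  (∀ₚI (⇒I (∨E excluded-middle (∨I₂ (∃ᵢE hyp₀ (cut j∈W Z⊆W))) (∨I₁ (noMember⇒Empty hyp₀)))))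
  where
  Γy : List (Formula _ (suc _) (suc _))
  Γy = P zero x0 ∷ map wkI (∃ᵢ (P zero x0) ∷ (zero ⊆ᶠ suc Z) ∷ map wkP Γ)
  j∈W : Γy ⊢ P zero (var (suc j))
  j∈W = ≐-subst-P (⇔E₁ (∀ᵢE (var zero) (hyp (there (there (there (∈-map⁺ wkI (∈-map⁺ wkP Z-def)))))))
                       (⇒E (∀ᵢE (var zero) hyp₂) hyp₀))
                  hyp₀
  Z⊆W : P zero (var (suc j)) ∷ Γy ⊢ wkI (suc Z ⊆ᶠ zero)
  Z⊆W = ∀ᵢI (⇒I (≐-subst-P (≐-sym (⇔E₁ (∀ᵢE (var zero) (hyp (there (there (there (there (there
                    (∈-map⁺ wkI (∈-map⁺ wkI (∈-map⁺ wkP Z-def))))))))))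
                  hyp₀))
                hyp₁))

Pin : Fin m → Fin n → List (Formula k n m) → Set
Pin X a Γ = P X (var a) ∈ Γ × Sing X ∈ Γ

Pin-∷ : ∀ {X a} → Pin X a Γ → Pin X a (φ ∷ Γ)
Pin-∷ (x∈X , sX) = there x∈X , there sX

Pin-wkI : ∀ {X a} → Pin X a Γ → Pin X (suc a) (map wkI Γ)
Pin-wkI (x∈X , sX) = ∈-map⁺ wkI x∈X , ∈-map⁺ wkI sX

Pin-wkP : ∀ {X a} → Pin X a Γ → Pin (suc X) a (map wkP Γ)
Pin-wkP (x∈X , sX) = ∈-map⁺ wkP x∈X , ∈-map⁺ wkP sX

Pinned : (Fin p → Fin n) → (Fin p → Fin m) → List (Formula k n m) → Set
Pinned ι ρ Γ = ∀ i → Pin (ρ i) (ι i) Γ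

Pinned-ext : ∀ {ι : Fin p → Fin n} {ρ : Fin p → Fin m} {Γ : List (Formula k (suc n) (suc m))} →
  Pin zero zero Γ → Pinned (suc ∘ ι) (suc ∘ ρ) Γ → Pinned (ext ι) (ext ρ) Γ
Pinned-ext pin₀ pins zero    = pin₀
Pinned-ext pin₀ pins (suc i) = pins i

Pin-unique : ∀ {X a b} → Pin X a Γ → Γ ⊢ P X (var b) → Γ ⊢ var b ≐ var a
Pin-unique (a∈X , sX) = Sing-unique (hyp sX) (hyp a∈X)

Pin-member⇒⊆ : ∀ {X Y a} → Pin X a Γ → Γ ⊢ P Y (var a) → Γ ⊢ X ⊆ᶠ Y
Pin-member⇒⊆ pin h =
  cut h (∀ᵢI (⇒I (≐-subst-P (≐-sym (Pin-unique (Pin-∷ (Pin-∷ (Pin-wkI pin))) hyp₀)) hyp₁)))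

Pin-⊆⇒member : ∀ {X Y a} → Pin X a Γ → Γ ⊢ X ⊆ᶠ Y → Γ ⊢ P Y (var a)
Pin-⊆⇒member {a = a} (a∈X , _) h = ⇒E (∀ᵢE (var a) h) (hyp a∈X)

Pin-≐⇒FSucc : ∀ {X Y a b d} → Pin X a Γ → Pin Y b Γ → Γ ⊢ S d (var a) ≐ var b → Γ ⊢ FSuccP d X Y
Pin-≐⇒FSucc {a = a} {b} (a∈X , _) (b∈Y , _) h = ∃ᵢI (var a) (∃ᵢI (var b) (∧I (hyp a∈X) (∧I (hyp b∈Y) h)))

Pin-FSucc⇒≐ : ∀ {X Y a b d} → Pin X a Γ → Pin Y b Γ → Γ ⊢ FSuccP d X Y → Γ ⊢ S d (var a) ≐ var b
Pin-FSucc⇒≐ pinX pinY h = ∃ᵢE h (∃ᵢE hyp₀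
  (≐-subst-S-val (Pin-unique (under₂ pinY) (∧E₁ (∧E₂ hyp₀)))
    (≐-subst-S-arg (Pin-unique (under₂ pinX) (∧E₁ hyp₀)) (∧E₂ (∧E₂ hyp₀)))))
  where
  under₂ : ∀ {X a} {φ ψ : Formula _ _ _} → Pin X a Γ → Pin X (suc (suc a)) (φ ∷ ψ ∷ map wkI (map wkI Γ))
  under₂ = Pin-∷ ∘ Pin-∷ ∘ Pin-wkI ∘ Pin-wkI

embᵍ : RForm k p q → (Fin p → Fin n) → (Fin q → Fin m) → Formula k n m
embᵍ (mem j i)     ι σ = P (σ j) (var (ι i))
embᵍ (fsucc d i j) ι σ = S d (var (ι i)) ≐ var (ι j)
embᵍ (φ ∨ʳ ψ)      ι σ = embᵍ φ ι σ ∨ᶠ embᵍ ψ ι σ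
embᵍ (¬ʳ φ)        ι σ = ¬ᶠ embᵍ φ ι σ
embᵍ (∃ʳᵢ φ)       ι σ = ∃ᵢ (embᵍ φ (ext ι) σ)
embᵍ (∃ʳₚ φ)       ι σ = ∃ₚ (embᵍ φ ι (ext σ))

embᵍ-id : (φ : RForm k p q) (ι : Fin p → Fin p) (σ : Fin q → Fin m) →
  (∀ i → ι i ≡ i) → embᵍ φ ι σ ≡ renP σ (emb φ)
embᵍ-id (mem j i)     ι σ ι≗id = cong (P (σ j) ∘ var) (ι≗id i)
embᵍ-id (fsucc d i j) ι σ ι≗id = cong₂ (λ a b → S d (var a) ≐ var b) (ι≗id i) (ι≗id j)
embᵍ-id (φ ∨ʳ ψ)      ι σ ι≗id = cong₂ _∨ᶠ_ (embᵍ-id φ ι σ ι≗id) (embᵍ-id ψ ι σ ι≗id)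
embᵍ-id (¬ʳ φ)        ι σ ι≗id = cong ¬ᶠ_ (embᵍ-id φ ι σ ι≗id)
embᵍ-id (∃ʳᵢ φ)       ι σ ι≗id = cong ∃ᵢ (embᵍ-id φ (ext ι) σ ext-ι≗id)
  where
  ext-ι≗id : ∀ i → ext ι i ≡ i
  ext-ι≗id zero    = refl
  ext-ι≗id (suc i) = cong suc (ι≗id i)
embᵍ-id (∃ʳₚ φ)       ι σ ι≗id = cong ∃ₚ (embᵍ-id φ ι (ext σ) ι≗id)

substI-embᵍ : (φ : RForm k p q) (ι : Fin p → Fin n) (ι' : Fin p → Fin n') (σ : Fin q → Fin m)
  (τ : Fin n → Term k n') → (∀ i → τ (ι i) ≡ var (ι' i)) → substI τ (embᵍ φ ι σ) ≡ embᵍ φ ι' σ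
substI-embᵍ (mem j i)     ι ι' σ τ τι≗ι' = cong (P (σ j)) (τι≗ι' i)
substI-embᵍ (fsucc d i j) ι ι' σ τ τι≗ι' = cong₂ _≐_ (cong (S d) (τι≗ι' i)) (τι≗ι' j)
substI-embᵍ (φ ∨ʳ ψ)      ι ι' σ τ τι≗ι' =
  cong₂ _∨ᶠ_ (substI-embᵍ φ ι ι' σ τ τι≗ι') (substI-embᵍ ψ ι ι' σ τ τι≗ι')
substI-embᵍ (¬ʳ φ)        ι ι' σ τ τι≗ι' = cong ¬ᶠ_ (substI-embᵍ φ ι ι' σ τ τι≗ι')
substI-embᵍ (∃ʳᵢ φ)       ι ι' σ τ τι≗ι' = cong ∃ᵢ (substI-embᵍ φ (ext ι) (ext ι') σ (extS τ) ext≗)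
  where
  ext≗ : ∀ i → extS τ (ext ι i) ≡ var (ext ι' i)
  ext≗ zero    = refl
  ext≗ (suc i) = cong (renT suc) (τι≗ι' i)
substI-embᵍ (∃ʳₚ φ)       ι ι' σ τ τι≗ι' = cong ∃ₚ (substI-embᵍ φ ι ι' (ext σ) τ τι≗ι')

renP-embᵍ : (φ : RForm k p q) (ι : Fin p → Fin n) (σ : Fin q → Fin m) (σ' : Fin q → Fin m')
  (τ : Fin m → Fin m') → (∀ j → τ (σ j) ≡ σ' j) → renP τ (embᵍ φ ι σ) ≡ embᵍ φ ι σ'
renP-embᵍ (mem j i)     ι σ σ' τ τσ≗σ' = cong (λ Y → P Y (var (ι i))) (τσ≗σ' j)
renP-embᵍ (fsucc d i j) ι σ σ' τ τσ≗σ' = refl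
renP-embᵍ (φ ∨ʳ ψ)      ι σ σ' τ τσ≗σ' =
  cong₂ _∨ᶠ_ (renP-embᵍ φ ι σ σ' τ τσ≗σ') (renP-embᵍ ψ ι σ σ' τ τσ≗σ')
renP-embᵍ (¬ʳ φ)        ι σ σ' τ τσ≗σ' = cong ¬ᶠ_ (renP-embᵍ φ ι σ σ' τ τσ≗σ')
renP-embᵍ (∃ʳᵢ φ)       ι σ σ' τ τσ≗σ' = cong ∃ᵢ (renP-embᵍ φ (ext ι) σ σ' τ τσ≗σ')
renP-embᵍ (∃ʳₚ φ)       ι σ σ' τ τσ≗σ' = cong ∃ₚ (renP-embᵍ φ ι (ext σ) (ext σ') (ext τ) ext≗)
  where
  ext≗ : ∀ j → ext τ (ext σ j) ≡ ext σ' j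
  ext≗ zero    = refl
  ext≗ (suc j) = cong suc (τσ≗σ' j)

substI-IFᵍ : (φ : RForm k p q) (ρ : Fin p → Fin m) (σ : Fin q → Fin m) (τ : Fin n → Term k n') →
  substI τ (IFᵍ φ ρ σ) ≡ IFᵍ φ ρ σ
substI-IFᵍ (mem j i)     ρ σ τ = refl
substI-IFᵍ (fsucc d i j) ρ σ τ = refl
substI-IFᵍ (φ ∨ʳ ψ)      ρ σ τ = cong₂ _∨ᶠ_ (substI-IFᵍ φ ρ σ τ) (substI-IFᵍ ψ ρ σ τ)
substI-IFᵍ (¬ʳ φ)        ρ σ τ = cong ¬ᶠ_ (substI-IFᵍ φ ρ σ τ)
substI-IFᵍ (∃ʳᵢ φ)       ρ σ τ = cong (λ F → ∃ₚ (Sing zero ∧ᶠ F)) (substI-IFᵍ φ _ _ τ)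
substI-IFᵍ (∃ʳₚ φ)       ρ σ τ = cong ∃ₚ (substI-IFᵍ φ _ _ τ)

renP-inverse : (F : Formula k n m) (τ : Fin m' → Fin m) (τ' : Fin m → Fin m') →
  (∀ X → τ (τ' X) ≡ X) → renP τ (renP τ' F) ≡ F
renP-inverse (P X t)  τ τ' ττ'≗id = cong (λ Y → P Y t) (ττ'≗id X)
renP-inverse (t ≐ u)  τ τ' ττ'≗id = refl
renP-inverse (t ≺ u)  τ τ' ττ'≗id = refl
renP-inverse (F ∨ᶠ G) τ τ' ττ'≗id = cong₂ _∨ᶠ_ (renP-inverse F τ τ' ττ'≗id) (renP-inverse G τ τ' ττ'≗id)
renP-inverse (¬ᶠ F)   τ τ' ττ'≗id = cong ¬ᶠ_ (renP-inverse F τ τ' ττ'≗id)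
renP-inverse (∃ᵢ F)   τ τ' ττ'≗id = cong ∃ᵢ (renP-inverse F τ τ' ττ'≗id)
renP-inverse (∃ₚ F)   τ τ' ττ'≗id = cong ∃ₚ (renP-inverse F (ext τ) (ext τ') ext≗id)
  where
  ext≗id : ∀ X → ext τ (ext τ' X) ≡ X
  ext≗id zero    = refl
  ext≗id (suc X) = cong suc (ττ'≗id X)

∃ₚI₀ : (F : Formula k n (suc m)) → Γ ⊢ F → Γ ⊢ wkP (∃ₚ F)
∃ₚI₀ F h =
  ∃ₚI zero (cast (sym (renP-inverse F _ (ext suc) λ { zero → refl ; (suc X) → refl })) h)

∃ᵢI₀-embᵍ : (φ : RForm k (suc p) q) (ι : Fin p → Fin n) (σ : Fin q → Fin m) →
  Γ ⊢ embᵍ φ (ext ι) σ → Γ ⊢ wkI (∃ᵢ (embᵍ φ (ext ι) σ))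
∃ᵢI₀-embᵍ φ ι σ h =
  cast (cong ∃ᵢ (sym (substI-embᵍ φ (ext ι) (ext (suc ∘ ι)) σ _ λ { zero → refl ; (suc i) → refl })))
    (∃ᵢI (var zero)
      (cast (sym (substI-embᵍ φ (ext (suc ∘ ι)) (ext ι) σ _ λ { zero → refl ; (suc i) → refl })) h))

emb⇒IF : (φ : RForm k p q) (ι : Fin p → Fin n) (ρ : Fin p → Fin m) (σ : Fin q → Fin m) →
  Pinned ι ρ Γ → Γ ⊢ embᵍ φ ι σ → Γ ⊢ IFᵍ φ ρ σ
IF⇒emb : (φ : RForm k p q) (ι : Fin p → Fin n) (ρ : Fin p → Fin m) (σ : Fin q → Fin m) →
  Pinned ι ρ Γ → Γ ⊢ IFᵍ φ ρ σ → Γ ⊢ embᵍ φ ι σ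

emb⇒IF (mem j i)     ι ρ σ pins = Pin-member⇒⊆ (pins i)
emb⇒IF (fsucc d i j) ι ρ σ pins = Pin-≐⇒FSucc (pins i) (pins j)
emb⇒IF (φ ∨ʳ ψ)      ι ρ σ pins h =
  ∨E h (∨I₁ (emb⇒IF φ ι ρ σ (Pin-∷ ∘ pins) hyp₀)) (∨I₂ (emb⇒IF ψ ι ρ σ (Pin-∷ ∘ pins) hyp₀))
emb⇒IF (¬ʳ φ)        ι ρ σ pins h = ¬I⊥ (¬E (IF⇒emb φ ι ρ σ (Pin-∷ ∘ pins) hyp₀) (weaken₁ h))
emb⇒IF (∃ʳₚ φ)       ι ρ σ pins h =
  ∃ₚE h (∃ₚI₀ _ (emb⇒IF φ ι (suc ∘ ρ) (ext σ) (Pin-∷ ∘ Pin-wkP ∘ pins) hyp₀))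
emb⇒IF {Γ = Γ} (∃ʳᵢ φ) ι ρ σ pins h =
  ∃ᵢE h (cast (sym (substI-IFᵍ (∃ʳᵢ φ) ρ σ _))
    (∃ₚE (axiom (comprehension (x0 ≐ var (suc zero))))
      (∃ₚI₀ (Sing zero ∧ᶠ IFᵍ φ (ext ρ) (suc ∘ σ)) (∧I (singleton-Sing (here refl)) IF-φ))))
  where
  Γ₁ : List (Formula _ _ (suc _))
  Γ₁ = ∀ᵢ (P zero x0 ⇔ᶠ x0 ≐ var (suc zero)) ∷ map wkP (embᵍ φ (ext ι) σ ∷ map wkI Γ)
  x∈Z : Sing zero ∷ Γ₁ ⊢ P zero (var zero)
  x∈Z = ⇔E₂ (∀ᵢE (var zero) hyp₁) (≐-refl (var zero))
  pins₁ : Pinned (ext ι) (ext ρ) (P zero (var zero) ∷ Sing zero ∷ Γ₁)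
  pins₁ = Pinned-ext (here refl , there (here refl)) (Pin-∷ ∘ Pin-∷ ∘ Pin-∷ ∘ Pin-wkP ∘ Pin-∷ ∘ Pin-wkI ∘ pins)
  emb-φ : P zero (var zero) ∷ Sing zero ∷ Γ₁ ⊢ embᵍ φ (ext ι) (suc ∘ σ)
  emb-φ = cast (renP-embᵍ φ (ext ι) σ (suc ∘ σ) suc λ _ → refl) (hyp (there (there (there (here refl)))))
  IF-φ : Γ₁ ⊢ IFᵍ φ (ext ρ) (suc ∘ σ)
  IF-φ = cut (singleton-Sing (here refl)) (cut x∈Z (emb⇒IF φ (ext ι) (ext ρ) (suc ∘ σ) pins₁ emb-φ))

IF⇒emb (mem j i)     ι ρ σ pins = Pin-⊆⇒member (pins i)
IF⇒emb (fsucc d i j) ι ρ σ pins = Pin-FSucc⇒≐ (pins i) (pins j)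
IF⇒emb (φ ∨ʳ ψ)      ι ρ σ pins h =
  ∨E h (∨I₁ (IF⇒emb φ ι ρ σ (Pin-∷ ∘ pins) hyp₀)) (∨I₂ (IF⇒emb ψ ι ρ σ (Pin-∷ ∘ pins) hyp₀))
IF⇒emb (¬ʳ φ)        ι ρ σ pins h = ¬I⊥ (¬E (emb⇒IF φ ι ρ σ (Pin-∷ ∘ pins) hyp₀) (weaken₁ h))
IF⇒emb (∃ʳₚ φ)       ι ρ σ pins h =
  ∃ₚE h (∃ₚI₀ _ (IF⇒emb φ ι (suc ∘ ρ) (ext σ) (Pin-∷ ∘ Pin-wkP ∘ pins) hyp₀))
IF⇒emb {Γ = Γ} (∃ʳᵢ φ) ι ρ σ pins h =
  ∃ₚE h (cast (sym (cong ∃ᵢ (renP-embᵍ φ (ext ι) σ (suc ∘ σ) suc λ _ → refl)))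
    (cut (∧E₁ hyp₀) (cut (∧E₂ hyp₁)
      (∃ᵢE (nonEmpty⇒member (∧E₁ hyp₁)) (∃ᵢI₀-embᵍ φ ι (suc ∘ σ) emb-φ)))))
  where
  IF' : Formula _ _ (suc _)
  IF' = IFᵍ φ (ext ρ) (suc ∘ σ)
  Γ₀ : List (Formula _ _ (suc _))
  Γ₀ = (Sing zero ∧ᶠ IF') ∷ map wkP Γ
  Γ₁ : List (Formula _ (suc _) (suc _))
  Γ₁ = P zero x0 ∷ wkI IF' ∷ Sing zero ∷ map wkI Γ₀
  pins₁ : Pinned (ext ι) (ext ρ) Γ₁
  pins₁ = Pinned-ext (here refl , there (there (here refl))) (Pin-∷ ∘ Pin-∷ ∘ Pin-∷ ∘ Pin-∷ ∘ Pin-wkI ∘ Pin-wkP ∘ pins)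
  emb-φ : Γ₁ ⊢ embᵍ φ (ext ι) (suc ∘ σ)
  emb-φ = IF⇒emb φ (ext ι) (ext ρ) (suc ∘ σ) pins₁ (cast (substI-IFᵍ φ (ext ρ) (suc ∘ σ) _) hyp₁)

Hyps-pinned : ∀ k p q → Pinned id (Xv q) (Hyps k p q)
Hyps-pinned k p q i =
  ∈-++⁺ˡ (∈-map⁺ (λ j → P (Xv q j) (var j)) (∈-allFin i)) ,
  ∈-++⁺ʳ _ (∈-map⁺ (λ j → Sing (Xv q j)) (∈-allFin i))

lemma8p7 : (k p q : ℕ) (φ : RForm k p q) → Hyps k p q ⊢ (embXY φ ⇔ᶠ IF φ)
lemma8p7 k p q φ = cast (cong (_⇔ᶠ IF φ) (embᵍ-id φ id (Yv p) λ _ → refl))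
  (⇔I (emb⇒IF φ id (Xv q) (Yv p) pins hyp₀) (IF⇒emb φ id (Xv q) (Yv p) pins hyp₀))
  where
  pins : ∀ {ψ} → Pinned id (Xv q) (ψ ∷ Hyps k p q)
  pins = Pin-∷ ∘ Hyps-pinned k p q
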